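{- Let $G$ be a cubic graph and let $h \geq 4$ be an integer. Let $G^{s-h-c}$ be the semi-$h$-corona of $G$. Then $$\chi''_=(G^{s-h-c}) = \Delta(G^{s-h-c}) + 1 = h+4.$$
   Context: All graphs are finite, simple, undirected. A semi-graph is a triple $(V,E,S)$ where $V$ is a vertex set, $E$ a set of edges with two distinct endpoints in $V$, and $S$ a set of semi-edges, each having exactly one endpoint in $V$. The semi-$h$-corona $G^{s-h-c}$ of a graph $G$ is the semi-graph obtained from $G$ by attaching $h$ semi-edges to each vertex of $G$; for cubic $G$ every vertex has degree $h+3$ (counting edges and semi-edges), so $\Delta(G^{s-h-c})=h+3$. A $k$-total-coloring of a (semi-)graph assigns one of $k$ colors to every vertex, edge and semi-edge so that adjacent vertices get different colors, edges/semi-edges sharing an endpoint get different colors, and every vertex gets a color different from all edges and semi-edges incident to it. A $k$-total-coloring is equitable if the numbers of elements in any two color classes differ by at most one; $\chi''_=$ denotes the least $k$ admitting an equitable $k$-total-coloring (the equitable total chromatic number). -}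

module Defs where

open import Data.Nat using (ℕ; zero; suc; _+_; _≤_; _<_)
open import Data.Fin as F using (Fin)
open import Data.Bool using (Bool; true; false; T; _∧_)
open import Data.Product using (Σ; _×_; _,_)
open import Relation.Nullary using (¬_; does)
open import Relation.Binary.PropositionalEquality using (_≡_; _≢_)

count : (n : ℕ) → (Fin n → Bool) → ℕ
count zero    p = 0
count (suc n) p = (if p F.zero then 1 else 0) + count n (λ i → p (F.suc i))
  where open import Data.Bool using (if_then_else_)

sumF : (n : ℕ) → (Fin n → ℕ) → ℕ
sumF zero    f = 0
sumF (suc n) f = f F.zero + sumF n (λ i → f (F.suc i))

record Graph (n : ℕ) : Set where
  field
    adj     : Fin n → Fin n → Bool
    adj-sym : ∀ u v → adj u v ≡ adj v u
    adj-irr : ∀ u → adj u u ≡ false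
open Graph public

degree : ∀ {n} → Graph n → Fin n → ℕ
degree {n} G v = count n (λ u → adj G v u)

Cubic : ∀ {n} → Graph n → Set
Cubic {n} G = ∀ v → degree G v ≡ 3

-- semi-graph on Fin n: an underlying simple graph (the edges) and,
-- for each vertex v, a number semi v of semi-edges whose unique endpoint is v;
-- the semi-edges at v are indexed by Fin (semi v)
record SemiGraph (n : ℕ) : Set where
  field
    graph : Graph n
    semi  : Fin n → ℕ
open SemiGraph public

semiCorona : ∀ {n} → Graph n → ℕ → SemiGraph n
semiCorona G h = record { graph = G ; semi = λ _ → h }

-- a k-total-colouring of a semi-graph.  The edge colouring ec is a function
-- on ordered pairs, required symmetric on edges; only its values on edges matter.
record TotalColoring {n : ℕ} (S : SemiGraph n) (k : ℕ) : Set where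
  private
    A = adj (graph S)
  field
    vc : Fin n → Fin k
    ec : Fin n → Fin n → Fin k
    sc : (v : Fin n) → Fin (semi S v) → Fin k
    ec-sym      : ∀ u v → T (A u v) → ec u v ≡ ec v u
    vv-proper   : ∀ u v → T (A u v) → vc u ≢ vc v
    ee-proper   : ∀ u v w → T (A u v) → T (A u w) → v ≢ w → ec u v ≢ ec u w
    es-proper   : ∀ u v (s : Fin (semi S u)) → T (A u v) → ec u v ≢ sc u s
    ss-proper   : ∀ u (s t : Fin (semi S u)) → s ≢ t → sc u s ≢ sc u t
    ve-proper   : ∀ u v → T (A u v) → vc u ≢ ec u v
    vs-proper   : ∀ u (s : Fin (semi S u)) → vc u ≢ sc u s
open TotalColoring public

-- number of elements (vertices, edges, semi-edges) of colour c;
-- each edge {u,v} is counted once, via the ordered pair with u < v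
classSize : ∀ {n k} {S : SemiGraph n} → TotalColoring S k → Fin k → ℕ
classSize {n} {k} {S} τ c =
    count n (λ v → does (vc τ v F.≟ c))
  + sumF n (λ u → count n (λ v →
        does (u F.<? v) ∧ adj (graph S) u v ∧ does (ec τ u v F.≟ c)))
  + sumF n (λ v → count (semi S v) (λ s → does (sc τ v s F.≟ c)))

Equitable : ∀ {n k} {S : SemiGraph n} → TotalColoring S k → Set
Equitable {k = k} τ = ∀ (c d : Fin k) → classSize τ c ≤ suc (classSize τ d)

HasEquitableTotalColoring : ∀ {n} → SemiGraph n → ℕ → Set
HasEquitableTotalColoring S k = Σ (TotalColoring S k) Equitable

EquitableTotalChromaticNumber : ∀ {n} → SemiGraph n → ℕ → Set
EquitableTotalChromaticNumber S k =
  HasEquitableTotalColoring S k × (∀ j → j < k → ¬ HasEquitableTotalColoring S j)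

semiDegree : ∀ {n} → SemiGraph n → Fin n → ℕ
semiDegree S v = degree (graph S) v + semi S v

MaxDegree : ∀ {n} → SemiGraph n → ℕ → Set
MaxDegree {n} S d = (∀ v → semiDegree S v ≤ d) × Σ (Fin n) (λ v → semiDegree S v ≡ d)

-- Lower bound: the vertex, the three edges and the h semi-edges at any vertex pairwise conflict, so they
-- need h + 4 distinct colours.  Upper bound: colour the edges by an equitable proper colouring of the line
-- graph, which has maximum degree 4, so that h + 4 ≥ 2 · 4 colours suffice (add vertices one at a time,
-- moving one vertex into a smallest class when necessary); colour the vertices greedily, avoiding the
-- colours of their neighbours and incident edges; and give the h semi-edges at a vertex the h colours left
-- there.  Then every colour occurs exactly once at each vertex, so a colour class containing e edges has
-- n − e elements, and the balance of the edge classes carries over to the whole colouring.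

module Submission where

open import Defs
open import Data.Nat using (ℕ; zero; suc; _+_; _*_; _≤_; _<_; z≤n; s≤s; _≤?_; _≟_)
open import Data.Nat.Properties
  using ( +-commutativeSemigroup; +-assoc; +-comm; +-suc; +-identityʳ
        ; +-mono-≤; +-monoˡ-≤; +-monoʳ-≤; +-cancelˡ-≤; +-cancelʳ-≤; +-cancelˡ-<; *-comm; *-suc; *-zeroʳ; *-monoʳ-≤
        ; ≤-refl; ≤-reflexive; ≤-trans; ≤-antisym; ≤-pred; <-irrefl; <⇒≤; <⇒≱; ≤∧≢⇒<
        ; ≮⇒≥; ≰⇒>; 1+n≢n; n≤1+n; m≤m+n; m≤n+m; m<m+n; m<n+m; m≤n⇒m≤1+n; module ≤-Reasoning )
open import Data.Fin as F using (Fin; zero; suc; _↑ˡ_; _↑ʳ_)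
import Data.Fin.Properties as FP
import Data.Bool as Bool
open import Data.Bool using (Bool; true; false; T; _∧_; _∨_; not; if_then_else_)
open import Algebra.Bundles using (CommutativeMonoid)
import Algebra.Properties.CommutativeSemigroup as CommutativeSemigroupProperties
open import Data.Bool.Properties
  using ( ∧-commutativeMonoid; ∨-commutativeMonoid; ∧-conicalˡ; ∧-conicalʳ; ∨-conicalˡ; ∨-conicalʳ
        ; ∧-zeroʳ; ∧-identityʳ; ∨-zeroʳ; ∧-assoc; ∧-comm; T-≡ )
open import Data.Product using (Σ; ∃; _×_; _,_; proj₁; proj₂; map)
open import Data.Sum using (_⊎_; inj₁; inj₂)
open import Data.Empty using (⊥; ⊥-elim)
open import Relation.Nullary using (Dec; yes; no; does)
open import Relation.Nullary.Decidable using (dec-true; dec-false; _×-dec_)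
open import Relation.Binary.PropositionalEquality
open import Data.Nat.Solver using (module +-*-Solver)
open +-*-Solver using (solve; _:+_; _:=_)
open import Function using (_∘_; id; case_of_)
open import Data.Vec.Functional using (_∷_; _++_; updateAt)
open import Function.Definitions using (Injective)
open import Function.Bundles using (Equivalence)
open import Data.Vec.Functional.Properties using (updateAt-updates; updateAt-minimal)

module ∧ = CommutativeSemigroupProperties (CommutativeMonoid.commutativeSemigroup ∧-commutativeMonoid)
module ∨ = CommutativeSemigroupProperties (CommutativeMonoid.commutativeSemigroup ∨-commutativeMonoid)
module + = CommutativeSemigroupProperties +-commutativeSemigroup

does⇒ : ∀ {P : Set} (p? : Dec P) → does p? ≡ true → P
does⇒ (yes p) _ = p

infix 4 _==_
_==_ : ∀ {m} → Fin m → Fin m → Bool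
a == b = does (a F.≟ b)

==-refl : ∀ {m} (a : Fin m) → (a == a) ≡ true
==-refl a = dec-true (a F.≟ a) refl

==-intro : ∀ {m} {a b : Fin m} → a ≡ b → (a == b) ≡ true
==-intro {a = a} {b} = dec-true (a F.≟ b)

==⇒≡ : ∀ {m} {a b : Fin m} → (a == b) ≡ true → a ≡ b
==⇒≡ {a = a} {b} = does⇒ (a F.≟ b)

==-sym : ∀ {m} (a b : Fin m) → (a == b) ≡ (b == a)
==-sym a b with a F.≟ b | b F.≟ a
... | yes _   | yes _   = refl
... | no  _   | no  _   = refl
... | yes a≡b | no  b≢a = ⊥-elim (b≢a (sym a≡b))
... | no  a≢b | yes b≡a = ⊥-elim (a≢b (sym b≡a))

≢⇒not== : ∀ {m} {a b : Fin m} → a ≢ b → not (a == b) ≡ true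
≢⇒not== {a = a} {b} a≢b = cong not (dec-false (a F.≟ b) a≢b)

infix 4 _<ᵇ_
_<ᵇ_ : ∀ {n} → Fin n → Fin n → Bool
u <ᵇ v = does (u F.<? v)

<ᵇ⇒< : ∀ {n} {u v : Fin n} → (u <ᵇ v) ≡ true → u F.< v
<ᵇ⇒< {u = u} {v} = does⇒ (u F.<? v)

<⇒<ᵇ : ∀ {n} {u v : Fin n} → u F.< v → (u <ᵇ v) ≡ true
<⇒<ᵇ {u = u} {v} = dec-true (u F.<? v)

<ᵇ≡false⇒> : ∀ {n} {u v : Fin n} → u ≢ v → (u <ᵇ v) ≡ false → v F.< u
<ᵇ≡false⇒> {u = u} {v} u≢v u≮v =
  FP.≤∧≢⇒< (≮⇒≥ (λ u<v → case trans (sym (<⇒<ᵇ u<v)) u≮v of λ ())) (u≢v ∘ sym)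

not-<ᵇ : ∀ {n} {u v : Fin n} → u ≢ v → not (u <ᵇ v) ≡ (v <ᵇ u)
not-<ᵇ {u = u} {v} u≢v with u <ᵇ v in u<v
... | true  = sym (dec-false (v F.<? u) (FP.<-asym (<ᵇ⇒< {u = u} {v} u<v)))
... | false = sym (<⇒<ᵇ (<ᵇ≡false⇒> u≢v u<v))

not≡true⇒≡false : ∀ {b} → not b ≡ true → b ≡ false
not≡true⇒≡false {false} _ = refl

∨-introˡ : ∀ {a} b → a ≡ true → a ∨ b ≡ true
∨-introˡ b refl = refl

∨-introʳ : ∀ a {b} → b ≡ true → a ∨ b ≡ true
∨-introʳ a refl = ∨-zeroʳ a

≡true⇒T : ∀ {b} → b ≡ true → T b
≡true⇒T = Equivalence.from T-≡

T⇒≡true : ∀ {b} → T b → b ≡ true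
T⇒≡true = Equivalence.to T-≡

separates : ∀ {A : Set} (p : A → Bool) {x y} → p x ≡ true → p y ≡ false → x ≢ y
separates p px py refl with () ← trans (sym px) py

∧==-false : ∀ {m} {a : Bool} {x y : Fin m} → (a ≡ true → x ≢ y) → a ∧ (x == y) ≡ false
∧==-false {a = false} _ = refl
∧==-false {a = true} {x} {y} apart = dec-false (x F.≟ y) (apart refl)

∧-at-value : ∀ {k} (P : Fin k → Bool) a (y c : Fin k) → (a ∧ P y) ∧ (y == c) ≡ P c ∧ (a ∧ (y == c))
∧-at-value P a y c with y F.≟ c
... | yes refl = trans (∧-identityʳ (a ∧ P y)) (trans (∧-comm a (P y)) (cong (P y ∧_) (sym (∧-identityʳ a))))
... | no  _    = trans (∧-zeroʳ (a ∧ P y)) (sym (trans (cong (P c ∧_) (∧-zeroʳ a)) (∧-zeroʳ (P c))))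

⟦_⟧ : Bool → ℕ
⟦ b ⟧ = if b then 1 else 0

+-≤1 : ∀ {x y} → x ≤ 1 → y ≤ 1 → (0 < x → y ≡ 0) → x + y ≤ 1
+-≤1 {zero}  _        y≤1 _     = y≤1
+-≤1 {suc _} (s≤s z≤n) _  x>0⇒y≡0 rewrite x>0⇒y≡0 (s≤s z≤n) = s≤s z≤n

count-cong : ∀ n {p q : Fin n → Bool} → (∀ i → p i ≡ q i) → count n p ≡ count n q
count-cong zero    p≡q = refl
count-cong (suc n) p≡q = cong₂ _+_ (cong ⟦_⟧ (p≡q zero)) (count-cong n (p≡q ∘ suc))

sumF-cong : ∀ n {f g : Fin n → ℕ} → (∀ i → f i ≡ g i) → sumF n f ≡ sumF n g
sumF-cong zero    f≡g = refl
sumF-cong (suc n) f≡g = cong₂ _+_ (f≡g zero) (sumF-cong n (f≡g ∘ suc))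

count-true : ∀ n → count n (λ _ → true) ≡ n
count-true zero    = refl
count-true (suc n) = cong suc (count-true n)

count-false : ∀ n {p : Fin n → Bool} → (∀ i → p i ≡ false) → count n p ≡ 0
count-false zero    p≡false = refl
count-false (suc n) p≡false rewrite p≡false zero = count-false n (p≡false ∘ suc)

count-mono : ∀ n {p q : Fin n → Bool} → (∀ i → p i ≡ true → q i ≡ true) → count n p ≤ count n q
count-mono zero    p⇒q = z≤n
count-mono (suc n) {p} {q} p⇒q with p zero in p₀ | q zero in q₀
... | true  | true  = s≤s (count-mono n (p⇒q ∘ suc))
... | true  | false with () ← trans (sym (p⇒q zero p₀)) q₀
... | false | true  = m≤n⇒m≤1+n (count-mono n (p⇒q ∘ suc))
... | false | false = count-mono n (p⇒q ∘ suc)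

count-∨ : ∀ n (p q : Fin n → Bool) → count n (λ i → p i ∨ q i) ≤ count n p + count n q
count-∨ zero    p q = z≤n
count-∨ (suc n) p q with p zero | q zero
... | true  | true  = s≤s (≤-trans (count-∨ n _ _) (+-monoʳ-≤ (count n (p ∘ suc)) (n≤1+n _)))
... | true  | false = s≤s (count-∨ n _ _)
... | false | true  = ≤-trans (s≤s (count-∨ n _ _)) (≤-reflexive (sym (+-suc _ _)))
... | false | false = count-∨ n _ _

count-split : ∀ n (p q : Fin n → Bool) →
  count n p ≡ count n (λ i → p i ∧ q i) + count n (λ i → p i ∧ not (q i))
count-split zero    p q = refl
count-split (suc n) p q with p zero | q zero
... | true  | true  = cong suc (count-split n _ _)
... | true  | false = trans (cong suc (count-split n _ _)) (sym (+-suc _ _))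
... | false | _     = count-split n _ _

count-complement : ∀ n (p : Fin n → Bool) → count n p + count n (not ∘ p) ≡ n
count-complement n p = trans (sym (count-split n (λ _ → true) p)) (count-true n)

count-== : ∀ n (a : Fin n) → count n (a ==_) ≡ 1
count-== (suc n) zero    = cong suc (count-false n (λ _ → refl))
count-== (suc n) (suc a) = trans (count-cong n ==-suc) (count-== n a)
  where
  ==-suc : ∀ c → (suc a == suc c) ≡ (a == c)
  ==-suc c with a F.≟ c
  ... | yes _ = refl
  ... | no  _ = refl

count-<⇒witness : ∀ n (p q : Fin n → Bool) → count n q < count n p →
  ∃ λ i → p i ≡ true × q i ≡ false
count-<⇒witness (suc n) p q q<p with p zero in p₀ | q zero in q₀
... | true  | false = zero , p₀ , q₀
... | true  | true  = map suc id (count-<⇒witness n (p ∘ suc) (q ∘ suc) (≤-pred q<p))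
... | false | true  = map suc id (count-<⇒witness n (p ∘ suc) (q ∘ suc) (≤-trans (n≤1+n _) q<p))
... | false | false = map suc id (count-<⇒witness n (p ∘ suc) (q ∘ suc) q<p)

count-≤1 : ∀ n (p : Fin n → Bool) → (∀ i j → p i ≡ true → p j ≡ true → i ≡ j) → count n p ≤ 1
count-≤1 zero    p unique = z≤n
count-≤1 (suc n) p unique with p zero in p₀
... | true  = s≤s (≤-reflexive (count-false n others))
  where
  others : ∀ i → p (suc i) ≡ false
  others i with p (suc i) in pᵢ
  ... | true  with () ← unique zero (suc i) p₀ pᵢ
  ... | false = refl
... | false = count-≤1 n (p ∘ suc) (λ i j pᵢ pⱼ → FP.suc-injective (unique (suc i) (suc j) pᵢ pⱼ))

count-==-≤1 : ∀ m {k} (p : Fin m → Bool) (f : Fin m → Fin k) c →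
  (∀ i j → p i ≡ true → p j ≡ true → i ≢ j → f i ≢ f j) → count m (λ j → p j ∧ (f j == c)) ≤ 1
count-==-≤1 m p f c apart = count-≤1 m _ unique
  where
  unique : ∀ i j → p i ∧ (f i == c) ≡ true → p j ∧ (f j == c) ≡ true → i ≡ j
  unique i j pᵢ pⱼ with i F.≟ j
  ... | yes i≡j = i≡j
  ... | no  i≢j = ⊥-elim (apart i j (∧-conicalˡ _ _ pᵢ) (∧-conicalˡ _ _ pⱼ) i≢j
                            (trans (==⇒≡ (∧-conicalʳ (p i) _ pᵢ)) (sym (==⇒≡ (∧-conicalʳ (p j) _ pⱼ)))))

count-pos⇒witness : ∀ n (p : Fin n → Bool) → 0 < count n p → ∃ λ i → p i ≡ true
count-pos⇒witness n p pos =
  map id proj₁ (count-<⇒witness n p (λ _ → false) (subst (_< count n p) (sym (count-false n (λ _ → refl))) pos))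

count-update : ∀ n (p p′ : Fin n → Bool) (y : Fin n) → (∀ i → i ≢ y → p′ i ≡ p i) →
  count n p′ + ⟦ p y ⟧ ≡ count n p + ⟦ p′ y ⟧
count-update (suc n) p p′ zero same rewrite count-cong n (λ i → same (suc i) λ ()) =
  +.xy∙z≈zy∙x ⟦ p′ zero ⟧ (count n (p ∘ suc)) ⟦ p zero ⟧
count-update (suc n) p p′ (suc y) same rewrite same zero (λ ()) =
  trans (+-assoc ⟦ p zero ⟧ _ _)
    (trans (cong (⟦ p zero ⟧ +_)
                 (count-update n (p ∘ suc) (p′ ∘ suc) y (λ i i≢y → same (suc i) (i≢y ∘ FP.suc-injective))))
      (sym (+-assoc ⟦ p zero ⟧ _ _)))

sumF-⟦⟧ : ∀ n (p : Fin n → Bool) → sumF n (λ i → ⟦ p i ⟧) ≡ count n p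
sumF-⟦⟧ zero    p = refl
sumF-⟦⟧ (suc n) p = cong (⟦ p zero ⟧ +_) (sumF-⟦⟧ n (p ∘ suc))

sumF-zero : ∀ n → sumF n (λ _ → 0) ≡ 0
sumF-zero n = trans (sumF-⟦⟧ n (λ _ → false)) (count-false n (λ _ → refl))

sumF-+ : ∀ n (f g : Fin n → ℕ) → sumF n (λ i → f i + g i) ≡ sumF n f + sumF n g
sumF-+ zero    f g = refl
sumF-+ (suc n) f g rewrite sumF-+ n (f ∘ suc) (g ∘ suc) = +.interchange (f zero) (g zero) _ _

sumF-mono : ∀ n {f g : Fin n → ℕ} → (∀ i → f i ≤ g i) → sumF n f ≤ sumF n g
sumF-mono zero    f≤g = z≤n
sumF-mono (suc n) f≤g = +-mono-≤ (f≤g zero) (sumF-mono n (f≤g ∘ suc))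

sumF-≤-*count : ∀ n (f : Fin n → ℕ) (p : Fin n → Bool) B →
  (∀ i → f i ≤ (if p i then B else 0)) → sumF n f ≤ B * count n p
sumF-≤-*count zero    f p B bound = z≤n
sumF-≤-*count (suc n) f p B bound with p zero | bound zero
... | true  | f₀≤B =
  ≤-trans (+-mono-≤ f₀≤B (sumF-≤-*count n (f ∘ suc) (p ∘ suc) B (bound ∘ suc))) (≤-reflexive (sym (*-suc B _)))
... | false | f₀≤0 = +-mono-≤ f₀≤0 (sumF-≤-*count n (f ∘ suc) (p ∘ suc) B (bound ∘ suc))

sumF-if : ∀ n (g : Fin n → ℕ) (p : Fin n → Bool) B → (∀ i → p i ≡ true → g i ≡ B) →
  sumF n (λ i → if p i then g i else 0) ≡ B * count n p
sumF-if zero    g p B const = sym (*-zeroʳ B)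
sumF-if (suc n) g p B const with p zero in p₀
... | true  = trans (cong₂ _+_ (const zero p₀) (sumF-if n (g ∘ suc) (p ∘ suc) B (const ∘ suc))) (sym (*-suc B _))
... | false = sumF-if n (g ∘ suc) (p ∘ suc) B (const ∘ suc)

sumF-≤1 : ∀ n (f : Fin n → ℕ) → (∀ i → f i ≤ 1) → sumF n f ≤ n
sumF-≤1 zero    f f≤1 = z≤n
sumF-≤1 (suc n) f f≤1 = +-mono-≤ (f≤1 zero) (sumF-≤1 n (f ∘ suc) (f≤1 ∘ suc))

sumF-≤1-with-zero : ∀ n (f : Fin n → ℕ) → (∀ i → f i ≤ 1) → ∀ i → f i ≡ 0 → sumF n f < n
sumF-≤1-with-zero (suc n) f f≤1 zero    f₀≡0 rewrite f₀≡0 = s≤s (sumF-≤1 n (f ∘ suc) (f≤1 ∘ suc))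
sumF-≤1-with-zero (suc n) f f≤1 (suc i) fᵢ≡0 =
  ≤-trans (≤-reflexive (sym (+-suc (f zero) _)))
          (+-mono-≤ (f≤1 zero) (sumF-≤1-with-zero n (f ∘ suc) (f≤1 ∘ suc) i fᵢ≡0))

sumF≡n⇒≡1 : ∀ n (f : Fin n → ℕ) → (∀ i → f i ≤ 1) → sumF n f ≡ n → ∀ i → f i ≡ 1
sumF≡n⇒≡1 n f f≤1 sum≡n i with f i in fᵢ | f≤1 i
... | 0           | _ = ⊥-elim (<-irrefl sum≡n (sumF-≤1-with-zero n f f≤1 i fᵢ))
... | 1           | _ = refl
... | suc (suc _) | s≤s ()

anyF : ∀ n → (Fin n → Bool) → Bool
anyF zero    p = false
anyF (suc n) p = p zero ∨ anyF n (p ∘ suc)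

anyF-intro : ∀ n (p : Fin n → Bool) i → p i ≡ true → anyF n p ≡ true
anyF-intro (suc n) p zero    pᵢ rewrite pᵢ = refl
anyF-intro (suc n) p (suc i) pᵢ with p zero
... | true  = refl
... | false = anyF-intro n (p ∘ suc) i pᵢ

anyF-false : ∀ n {p : Fin n → Bool} → (∀ i → p i ≡ false) → anyF n p ≡ false
anyF-false zero    p≡false = refl
anyF-false (suc n) p≡false rewrite p≡false zero = anyF-false n (p≡false ∘ suc)

count-anyF : ∀ m n (q : Fin n → Fin m → Bool) →
  count m (λ j → anyF n (λ a → q a j)) ≤ sumF n (λ a → count m (q a))
count-anyF m zero    q = ≤-reflexive (count-false m (λ _ → refl))
count-anyF m (suc n) q = ≤-trans (count-∨ m _ _) (+-monoʳ-≤ (count m (q zero)) (count-anyF m n (q ∘ suc)))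

count-∧-== : ∀ k (b : Bool) (x : Fin k) → count k (λ c → b ∧ (x == c)) ≡ ⟦ b ⟧
count-∧-== k true  x = count-== k x
count-∧-== k false x = count-false k (λ _ → refl)

count-image : ∀ m k (p : Fin m → Bool) (f : Fin m → Fin k) →
  count k (λ c → anyF m (λ j → p j ∧ (f j == c))) ≤ count m p
count-image m k p f = begin
  count k (λ c → anyF m (λ j → p j ∧ (f j == c)))  ≤⟨ count-anyF k m _ ⟩
  sumF m (λ j → count k (λ c → p j ∧ (f j == c)))   ≡⟨ sumF-cong m (λ j → count-∧-== k (p j) (f j)) ⟩
  sumF m (λ j → ⟦ p j ⟧)                            ≡⟨ sumF-⟦⟧ m p ⟩
  count m p                                         ∎
  where open ≤-Reasoning

count-byValue : ∀ m k (q : Fin m → Bool) (f : Fin m → Fin k) →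
  count m q ≡ sumF k (λ c → count m (λ j → q j ∧ (f j == c)))
count-byValue zero    k q f = sym (sumF-zero k)
count-byValue (suc m) k q f = sym (begin
  sumF k (λ c → ⟦ q zero ∧ (f zero == c) ⟧ + count m (λ j → q (suc j) ∧ (f (suc j) == c)))
    ≡⟨ sumF-+ k _ _ ⟩
  sumF k (λ c → ⟦ q zero ∧ (f zero == c) ⟧) + sumF k (λ c → count m (λ j → q (suc j) ∧ (f (suc j) == c)))
    ≡⟨ cong₂ _+_ (trans (sumF-⟦⟧ k _) (count-∧-== k (q zero) (f zero))) (sym (count-byValue m k (q ∘ suc) (f ∘ suc))) ⟩
  ⟦ q zero ⟧ + count m (q ∘ suc) ∎)
  where open ≡-Reasoning

count-∧-value : ∀ M {k} (a : Fin M → Bool) (P : Fin k → Bool) (f : Fin M → Fin k) c →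
  count M (λ j → (a j ∧ P (f j)) ∧ (f j == c)) ≡ (if P c then count M (λ j → a j ∧ (f j == c)) else 0)
count-∧-value M a P f c = trans (count-cong M (λ j → ∧-at-value P (a j) (f j) c)) (by-cases (P c))
  where
  by-cases : ∀ b → count M (λ j → b ∧ (a j ∧ (f j == c))) ≡ (if b then count M (λ j → a j ∧ (f j == c)) else 0)
  by-cases true  = refl
  by-cases false = count-false M (λ _ → refl)

sumF-count-comm : ∀ a b (Q : Fin a → Fin b → Bool) →
  sumF a (λ i → count b (Q i)) ≡ sumF b (λ j → count a (λ i → Q i j))
sumF-count-comm zero    b Q = sym (sumF-zero b)
sumF-count-comm (suc a) b Q = sym (trans (sumF-+ b (λ j → ⟦ Q zero j ⟧) _)
  (cong₂ _+_ (sumF-⟦⟧ b (Q zero)) (sym (sumF-count-comm a b (Q ∘ suc)))))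

sumF-count-==ʳ : ∀ n (x : Fin n) (P : Fin n → Bool) → sumF n (λ a → count n (λ b → (x == b) ∧ P a)) ≡ count n P
sumF-count-==ʳ n x P =
  trans (sumF-cong n (λ a → trans (count-cong n (λ b → ∧-comm (x == b) (P a))) (count-∧-== n (P a) x))) (sumF-⟦⟧ n P)

sumF-count-==ˡ : ∀ n (x : Fin n) (P : Fin n → Bool) → sumF n (λ a → count n (λ b → (x == a) ∧ P b)) ≡ count n P
sumF-count-==ˡ n x P = trans (sumF-count-comm n n _) (sumF-count-==ʳ n x P)

count-↑ : ∀ a b (p : Fin (a + b) → Bool) → count (a + b) p ≡ count a (λ i → p (i ↑ˡ b)) + count b (λ j → p (a ↑ʳ j))
count-↑ zero    b p = refl
count-↑ (suc a) b p = trans (cong (⟦ p zero ⟧ +_) (count-↑ a b (p ∘ suc))) (sym (+-assoc ⟦ p zero ⟧ _ _))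

count-combine : ∀ m n (q : Fin (m * n) → Bool) → count (m * n) q ≡ sumF m (λ u → count n (λ v → q (F.combine u v)))
count-combine zero    n q = refl
count-combine (suc m) n q = trans (count-↑ n (m * n) q) (cong (count n (λ v → q (v ↑ˡ (m * n))) +_) (count-combine m n _))

count-tail : ∀ n (p : Fin (suc n) → Bool) → count n (p ∘ suc) ≤ count (suc n) p
count-tail n p = m≤n+m _ ⟦ p zero ⟧

≢⇒injective : ∀ {m} {A : Set} (f : Fin m → A) → (∀ i j → i ≢ j → f i ≢ f j) → Injective _≡_ _≡_ f
≢⇒injective f apart {i} {j} eq with i F.≟ j
... | yes i≡j = i≡j
... | no  i≢j = ⊥-elim (apart i j i≢j eq)

injective-∷ : ∀ {m} {A : Set} (x : A) (xs : Fin m → A) → (∀ i → xs i ≢ x) →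
  Injective _≡_ _≡_ xs → Injective _≡_ _≡_ (x ∷ xs)
injective-∷ x xs fresh inj {zero}  {zero}  _  = refl
injective-∷ x xs fresh inj {zero}  {suc j} eq = ⊥-elim (fresh j (sym eq))
injective-∷ x xs fresh inj {suc i} {zero}  eq = ⊥-elim (fresh i eq)
injective-∷ x xs fresh inj {suc i} {suc j} eq = cong suc (inj eq)

injective-++ : ∀ {m n} {A : Set} (xs : Fin m → A) (ys : Fin n → A) → Injective _≡_ _≡_ xs → Injective _≡_ _≡_ ys →
  (∀ i j → xs i ≢ ys j) → Injective _≡_ _≡_ (xs ++ ys)
injective-++ {m} xs ys injˡ injʳ disjoint {i} {j} eq with F.splitAt m i in splitᵢ | F.splitAt m j in splitⱼ
... | inj₁ a | inj₁ b =
  trans (sym (FP.splitAt⁻¹-↑ˡ splitᵢ)) (trans (cong (_↑ˡ _) (injˡ eq)) (FP.splitAt⁻¹-↑ˡ splitⱼ))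
... | inj₁ a | inj₂ b = ⊥-elim (disjoint a b eq)
... | inj₂ a | inj₁ b = ⊥-elim (disjoint b a (sym eq))
... | inj₂ a | inj₂ b =
  trans (sym (FP.splitAt⁻¹-↑ʳ splitᵢ)) (trans (cong (m ↑ʳ_) (injʳ eq)) (FP.splitAt⁻¹-↑ʳ splitⱼ))

Enumeration : ∀ n → (Fin n → Bool) → ℕ → Set
Enumeration n p m = Σ (Fin m → Fin n) λ f → (∀ i → p (f i) ≡ true) × Injective _≡_ _≡_ f

enumerate : ∀ n (p : Fin n → Bool) → Enumeration n p (count n p)
enumerate zero    p = (λ ()) , (λ ()) , λ { {()} }
enumerate (suc n) p with p zero in p₀ | enumerate n (p ∘ suc)
... | true  | f , pf , inj =
  zero ∷ suc ∘ f , (λ { zero → p₀ ; (suc i) → pf i }) , injective-∷ zero (suc ∘ f) (λ _ ()) (inj ∘ FP.suc-injective)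
... | false | f , pf , inj = suc ∘ f , pf , inj ∘ FP.suc-injective

graph-tail : ∀ {n} → Graph (suc n) → Graph n
graph-tail G = record
  { adj     = λ u v → adj G (suc u) (suc v)
  ; adj-sym = λ u v → adj-sym G (suc u) (suc v)
  ; adj-irr = λ u → adj-irr G (suc u)
  }

degree-tail : ∀ {n} (G : Graph (suc n)) v → degree (graph-tail G) v ≤ degree G (suc v)
degree-tail {n} G v = count-tail n (adj G (suc v))

adj⇒≢ : ∀ {n} (G : Graph n) {u v} → adj G u v ≡ true → u ≢ v
adj⇒≢ G {u} uv refl with () ← trans (sym uv) (adj-irr G u)

ProperColouring : ∀ {n k} → Graph n → (Fin n → Fin k) → Set
ProperColouring G col = ∀ u v → adj G u v ≡ true → col u ≢ col v

proper-∷ : ∀ {n k} (G : Graph (suc n)) (c : Fin k) (col : Fin n → Fin k) →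
  ProperColouring (graph-tail G) col → (∀ j → adj G zero (suc j) ≡ true → col j ≢ c) →
  ProperColouring G (c ∷ col)
proper-∷ G c col proper avoid zero    zero    e = ⊥-elim (adj⇒≢ G e refl)
proper-∷ G c col proper avoid zero    (suc j) e = avoid j e ∘ sym
proper-∷ G c col proper avoid (suc i) zero    e = avoid i (trans (adj-sym G zero (suc i)) e)
proper-∷ G c col proper avoid (suc i) (suc j) e = proper i j e

neighbourColour₀ : ∀ {n k} → Graph (suc n) → (Fin n → Fin k) → Fin k → Bool
neighbourColour₀ {n} G col c = anyF n (λ j → adj G zero (suc j) ∧ (col j == c))

count-neighbourColour₀ : ∀ {n k} (G : Graph (suc n)) (col : Fin n → Fin k) →
  count k (neighbourColour₀ G col) ≤ degree G zero
count-neighbourColour₀ {n} {k} G col = ≤-trans (count-image n k (adj G zero ∘ suc) col) (count-tail n (adj G zero))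

neighbourColour₀-free : ∀ {n k} (G : Graph (suc n)) (col : Fin n → Fin k) c →
  neighbourColour₀ G col c ≡ false → ∀ j → adj G zero (suc j) ≡ true → col j ≢ c
neighbourColour₀-free {n} G col c free j e refl
  with () ← trans (sym (anyF-intro n _ j (cong₂ _∧_ e (==-refl (col j))))) free

greedyColouring : ∀ {N} d f k → d + f < k → (G : Graph N) → (∀ v → degree G v ≤ d) →
  (forbidden : Fin N → Fin k → Bool) → (∀ v → count k (forbidden v) ≤ f) →
  Σ (Fin N → Fin k) λ col → ProperColouring G col × (∀ v → forbidden v (col v) ≡ false)
greedyColouring {zero} d f k d+f<k G deg forbidden nforb = (λ ()) , (λ ()) , (λ ())
greedyColouring {suc M} d f k d+f<k G deg forbidden nforb
  with greedyColouring d f k d+f<k (graph-tail G) (λ v → ≤-trans (degree-tail G v) (deg (suc v))) (forbidden ∘ suc) (nforb ∘ suc)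
... | col , proper , allowed = c ∷ col , proper-∷ G c col proper (neighbourColour₀-free G col c c-free) , allowed′
  where
  blocked : Fin k → Bool
  blocked c = neighbourColour₀ G col c ∨ forbidden zero c

  few-blocked : count k blocked < count k (λ _ → true)
  few-blocked = begin-strict
    count k blocked
      ≤⟨ count-∨ k _ _ ⟩
    count k (neighbourColour₀ G col) + count k (forbidden zero)
      ≤⟨ +-mono-≤ (≤-trans (count-neighbourColour₀ G col) (deg zero)) (nforb zero) ⟩
    d + f
      <⟨ d+f<k ⟩
    k
      ≡⟨ count-true k ⟨
    count k (λ _ → true) ∎
    where open ≤-Reasoning

  free : ∃ λ c → true ≡ true × blocked c ≡ false
  free = count-<⇒witness k (λ _ → true) blocked few-blocked
  c : Fin k
  c = proj₁ free
  c-free : neighbourColour₀ G col c ≡ false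
  c-free = ∨-conicalˡ _ _ (proj₂ (proj₂ free))
  allowed′ : ∀ v → forbidden v ((c ∷ col) v) ≡ false
  allowed′ zero    = ∨-conicalʳ _ _ (proj₂ (proj₂ free))
  allowed′ (suc v) = allowed v

-- Equitable colourings of graphs of bounded degree

classCount : ∀ {N k} → (Fin N → Bool) → (Fin N → Fin k) → Fin k → ℕ
classCount {N} active col c = count N (λ i → active i ∧ (col i == c))

Balanced : ∀ {N k} → (Fin N → Bool) → (Fin N → Fin k) → Set
Balanced active col = ∀ c d → classCount active col c ≤ suc (classCount active col d)

argmin : ∀ {k} → 0 < k → (f : Fin k → ℕ) → ∃ λ c → ∀ d → f c ≤ f d
argmin {suc zero}    _ f = zero , λ { zero → ≤-refl }
argmin {suc (suc k)} _ f with argmin {suc k} (s≤s z≤n) (f ∘ suc)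
... | c , min with f zero ≤? f (suc c)
... | yes f₀≤ = zero , λ { zero → ≤-refl ; (suc d) → ≤-trans f₀≤ (min d) }
... | no  f₀≰ = suc c , λ { zero → <⇒≤ (≰⇒> f₀≰) ; (suc d) → min d }

bump-≤ : ∀ {k} (old : Fin k → ℕ) t x b c → old c ≤ suc t → old x ≡ t → old c + ⟦ b ∧ (x == c) ⟧ ≤ suc t
bump-≤ old t x true  c oldc≤1+t oldx≡t with x F.≟ c
... | yes refl = ≤-reflexive (trans (cong (_+ 1) oldx≡t) (+-comm t 1))
... | no  _    = ≤-trans (≤-reflexive (+-identityʳ _)) oldc≤1+t
bump-≤ old t x false c oldc≤1+t oldx≡t = ≤-trans (≤-reflexive (+-identityʳ _)) oldc≤1+t

-- Adding one element to a smallest class keeps all class sizes within [t, t + 1].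
balanced-bump : ∀ {k} (old new : Fin k → ℕ) t x b → (∀ c → t ≤ old c) → (∀ c → old c ≤ suc t) →
  old x ≡ t → (∀ c → new c ≡ old c + ⟦ b ∧ (x == c) ⟧) → ∀ c d → new c ≤ suc (new d)
balanced-bump old new t x b t≤old old≤1+t oldx≡t new≡ c d = begin
  new c                       ≡⟨ new≡ c ⟩
  old c + ⟦ b ∧ (x == c) ⟧    ≤⟨ bump-≤ old t x b c (old≤1+t c) oldx≡t ⟩
  suc t                       ≤⟨ s≤s (t≤old d) ⟩
  suc (old d)                 ≤⟨ s≤s (m≤m+n _ _) ⟩
  suc (old d + ⟦ b ∧ (x == d) ⟧) ≡⟨ cong suc (new≡ d) ⟨
  suc (new d)                 ∎
  where open ≤-Reasoning

module Extend {M Δ k : ℕ} (Δ+Δ≤k : Δ + Δ ≤ k) (Δ<k : Δ < k)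
  (G : Graph (suc M)) (active : Fin (suc M) → Bool)
  (adj⇒active : ∀ u v → adj G u v ≡ true → active u ≡ true) (deg : ∀ v → degree G v ≤ Δ)
  (col : Fin M → Fin k) (proper : ProperColouring (graph-tail G) col) (balanced : Balanced (active ∘ suc) col)
  where

  Extension : Set
  Extension = Σ (Fin (suc M) → Fin k) λ col′ → ProperColouring G col′ × Balanced active col′

  size : Fin k → ℕ
  size = classCount (active ∘ suc) col

  smallest : ∃ λ c → ∀ d → size c ≤ size d
  smallest = argmin (≤-trans (s≤s z≤n) Δ<k) size

  c₀ : Fin k
  c₀ = proj₁ smallest

  t : ℕ
  t = size c₀

  t≤size : ∀ c → t ≤ size c
  t≤size = proj₂ smallest

  size≤1+t : ∀ c → size c ≤ suc t
  size≤1+t c = balanced c c₀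

  adj-inactive : ∀ {u v} → active u ≡ false → adj G u v ≡ false
  adj-inactive {u} {v} inactive with adj G u v in e
  ... | true  with () ← trans (sym (adj⇒active u v e)) inactive
  ... | false = refl

  extendFree : ∀ c → size c ≡ t → neighbourColour₀ G col c ≡ false → Extension
  extendFree c size≡t free =
    c ∷ col , proper-∷ G c col proper (neighbourColour₀-free G col c free) ,
    balanced-bump size (classCount active (c ∷ col)) t c (active zero) t≤size size≤1+t size≡t (λ d → +-comm _ (size d))

  -- No smallest class is free at vertex 0: move a vertex y, all of whose neighbours avoid c₀ and whose colour
  -- is free at 0, into class c₀, and give 0 the old colour of y.  Such a y exists because the free classes
  -- hold (t + 1) · (k − Δ) > Δ t vertices, while at most Δ t vertices have a neighbour in class c₀.
  module Recolour (active₀ : active zero ≡ true)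
                  (no-free : ∀ c → size c ≡ t → neighbourColour₀ G col c ≡ false → ⊥) where

    free : Fin k → Bool
    free = not ∘ neighbourColour₀ G col

    nfree : ℕ
    nfree = count k free

    free⇒size≡1+t : ∀ c → neighbourColour₀ G col c ≡ false → size c ≡ suc t
    free⇒size≡1+t c isFree = ≤-antisym (size≤1+t c) (≤∧≢⇒< (t≤size c) (λ t≡size → no-free c (sym t≡size) isFree))

    k≤Δ+nfree : k ≤ Δ + nfree
    k≤Δ+nfree = begin
      k                                           ≡⟨ count-complement k (neighbourColour₀ G col) ⟨
      count k (neighbourColour₀ G col) + nfree    ≤⟨ +-monoˡ-≤ nfree (≤-trans (count-neighbourColour₀ G col) (deg zero)) ⟩
      Δ + nfree                                   ∎
      where open ≤-Reasoning

    Δ≤nfree : Δ ≤ nfree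
    Δ≤nfree = +-cancelˡ-≤ Δ Δ nfree (≤-trans Δ+Δ≤k k≤Δ+nfree)

    0<nfree : 0 < nfree
    0<nfree = +-cancelˡ-< Δ 0 nfree (≤-trans (≤-reflexive (cong suc (+-identityʳ Δ))) (≤-trans Δ<k k≤Δ+nfree))

    candidate : Fin M → Bool
    candidate j = active (suc j) ∧ free (col j)

    count-candidate : count M candidate ≡ suc t * nfree
    count-candidate = begin
      count M candidate
        ≡⟨ count-byValue M k candidate col ⟩
      sumF k (λ c → count M (λ j → candidate j ∧ (col j == c)))
        ≡⟨ sumF-cong k (count-∧-value M (active ∘ suc) free col) ⟩
      sumF k (λ c → if free c then size c else 0)
        ≡⟨ sumF-if k size free (suc t) (λ c → free⇒size≡1+t c ∘ not≡true⇒≡false) ⟩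
      suc t * nfree ∎
      where open ≡-Reasoning

    nearC₀ : Fin M → Bool
    nearC₀ j = anyF M (λ a → (col a == c₀) ∧ adj G (suc a) (suc j))

    count-nearC₀ : count M nearC₀ ≤ Δ * t
    count-nearC₀ = ≤-trans (count-anyF M M _) (sumF-≤-*count M _ _ Δ bound)
      where
      bound : ∀ a → count M (λ j → (col a == c₀) ∧ adj G (suc a) (suc j))
                  ≤ (if active (suc a) ∧ (col a == c₀) then Δ else 0)
      bound a with col a == c₀ | active (suc a) in activeₐ
      ... | false | _     = ≤-trans (≤-reflexive (count-false M (λ _ → refl))) z≤n
      ... | true  | true  = ≤-trans (degree-tail G a) (deg (suc a))
      ... | true  | false = ≤-reflexive (count-false M (λ _ → adj-inactive activeₐ))

    few-near : count M nearC₀ < count M candidate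
    few-near = begin-strict
      count M nearC₀     ≤⟨ count-nearC₀ ⟩
      Δ * t              ≡⟨ *-comm Δ t ⟩
      t * Δ              ≤⟨ *-monoʳ-≤ t Δ≤nfree ⟩
      t * nfree          <⟨ m<n+m _ 0<nfree ⟩
      suc t * nfree      ≡⟨ count-candidate ⟨
      count M candidate  ∎
      where open ≤-Reasoning

    moved : ∃ λ y → candidate y ≡ true × nearC₀ y ≡ false
    moved = count-<⇒witness M candidate nearC₀ few-near

    y : Fin M
    y = proj₁ moved

    y-active : active (suc y) ≡ true
    y-active = ∧-conicalˡ _ _ (proj₁ (proj₂ moved))

    b : Fin k
    b = col y

    b-free : neighbourColour₀ G col b ≡ false
    b-free = not≡true⇒≡false (∧-conicalʳ _ _ (proj₁ (proj₂ moved)))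

    b≢c₀ : b ≢ c₀
    b≢c₀ b≡c₀ = 1+n≢n (trans (sym (free⇒size≡1+t b b-free)) (cong size b≡c₀))

    no-c₀-near-y : ∀ j → adj G (suc j) (suc y) ≡ true → col j ≢ c₀
    no-c₀-near-y j e colⱼ≡c₀
      with () ← trans (sym (anyF-intro M _ j (cong₂ _∧_ (==-intro colⱼ≡c₀) e))) (proj₂ (proj₂ moved))

    recoloured : Fin M → Fin k
    recoloured = updateAt col y (λ _ → c₀)

    recoloured-y : recoloured y ≡ c₀
    recoloured-y = updateAt-updates y col

    recoloured-other : ∀ i → i ≢ y → recoloured i ≡ col i
    recoloured-other i i≢y = updateAt-minimal i y col i≢y

    recoloured-proper : ProperColouring (graph-tail G) recoloured
    recoloured-proper i j e with i F.≟ y | j F.≟ y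
    ... | yes refl | yes refl = ⊥-elim (adj⇒≢ (graph-tail G) e refl)
    ... | yes refl | no  j≢y  = λ eq → no-c₀-near-y j (trans (adj-sym G (suc j) (suc y)) e)
                                  (trans (sym (recoloured-other j j≢y)) (trans (sym eq) recoloured-y))
    ... | no  i≢y  | yes refl = λ eq → no-c₀-near-y i e (trans (sym (recoloured-other i i≢y)) (trans eq recoloured-y))
    ... | no  i≢y  | no  j≢y  = λ eq → proper i j e (trans (sym (recoloured-other i i≢y)) (trans eq (recoloured-other j j≢y)))

    b-avoids : ∀ j → adj G zero (suc j) ≡ true → recoloured j ≢ b
    b-avoids j e with j F.≟ y
    ... | yes refl = λ eq → b≢c₀ (trans (sym eq) recoloured-y)
    ... | no  j≢y  = neighbourColour₀-free G col b b-free j e ∘ trans (sym (recoloured-other j j≢y))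

    size-after : ∀ c → classCount active (b ∷ recoloured) c ≡ size c + ⟦ true ∧ (c₀ == c) ⟧
    size-after c = begin
      ⟦ active zero ∧ (b == c) ⟧ + classCount (active ∘ suc) recoloured c
        ≡⟨ cong (λ a → ⟦ a ∧ (b == c) ⟧ + classCount (active ∘ suc) recoloured c) active₀ ⟩
      ⟦ b == c ⟧ + classCount (active ∘ suc) recoloured c
        ≡⟨ +-comm ⟦ b == c ⟧ _ ⟩
      classCount (active ∘ suc) recoloured c + ⟦ b == c ⟧
        ≡⟨ cong (λ a → classCount (active ∘ suc) recoloured c + ⟦ a ∧ (b == c) ⟧) y-active ⟨
      classCount (active ∘ suc) recoloured c + ⟦ active (suc y) ∧ (col y == c) ⟧
        ≡⟨ count-update M _ _ y (λ i i≢y → cong (λ z → active (suc i) ∧ (z == c)) (recoloured-other i i≢y)) ⟩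
      size c + ⟦ active (suc y) ∧ (recoloured y == c) ⟧
        ≡⟨ cong₂ (λ a z → size c + ⟦ a ∧ (z == c) ⟧) y-active recoloured-y ⟩
      size c + ⟦ c₀ == c ⟧ ∎
      where open ≡-Reasoning

    extension : Extension
    extension =
      b ∷ recoloured , proper-∷ G b recoloured recoloured-proper b-avoids ,
      balanced-bump size (classCount active (b ∷ recoloured)) t c₀ true t≤size size≤1+t refl size-after

  extension : Extension
  extension = byActivity (active zero) refl
    where
    byActivity : ∀ a → active zero ≡ a → Extension
    byActivity false inactive₀ = extendFree c₀ refl (anyF-false M (λ j → cong (_∧ (col j == c₀)) (adj-inactive inactive₀)))
    byActivity true  active₀ with FP.any? (λ c → (size c ≟ t) ×-dec (neighbourColour₀ G col c Bool.≟ false))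
    ... | yes (c , size≡t , isFree) = extendFree c size≡t isFree
    ... | no  none                  = Recolour.extension active₀ (λ c size≡t isFree → none (c , size≡t , isFree))

equitableColouring : ∀ {N} Δ k → Δ + Δ ≤ k → Δ < k → (G : Graph N) (active : Fin N → Bool) →
  (∀ u v → adj G u v ≡ true → active u ≡ true) → (∀ v → degree G v ≤ Δ) →
  Σ (Fin N → Fin k) λ col → ProperColouring G col × Balanced active col
equitableColouring {zero}  Δ k Δ+Δ≤k Δ<k G active adj⇒active deg = (λ ()) , (λ ()) , (λ c d → z≤n)
equitableColouring {suc M} Δ k Δ+Δ≤k Δ<k G active adj⇒active deg
  with equitableColouring Δ k Δ+Δ≤k Δ<k (graph-tail G) (active ∘ suc) (λ u v → adj⇒active (suc u) (suc v))
         (λ v → ≤-trans (degree-tail G v) (deg (suc v)))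
... | col , proper , balanced = Extend.extension Δ+Δ≤k Δ<k G active adj⇒active deg col proper balanced

-- Line graphs

-- The line graph lives on the pairs (u , v) : Fin n × Fin n, encoded as Fin (n * n) by F.combine;
-- only the pairs with u < v that are edges of G take part.
isEdge : ∀ {n} → Graph n → Fin n → Fin n → Bool
isEdge G u v = (u <ᵇ v) ∧ adj G u v

shareEndpoint : ∀ {n} → Fin n → Fin n → Fin n → Fin n → Bool
shareEndpoint u v u′ v′ = (u == u′) ∨ (u == v′) ∨ (v == u′) ∨ (v == v′)

lineAdj : ∀ {n} → Graph n → Fin n → Fin n → Fin n → Fin n → Bool
lineAdj G u v u′ v′ = isEdge G u v ∧ (isEdge G u′ v′ ∧ (shareEndpoint u v u′ v′ ∧ not ((u == u′) ∧ (v == v′))))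

lineAdj-sym : ∀ {n} (G : Graph n) u v u′ v′ → lineAdj G u v u′ v′ ≡ lineAdj G u′ v′ u v
lineAdj-sym G u v u′ v′
  rewrite ==-sym u u′ | ==-sym u v′ | ==-sym v u′ | ==-sym v v′
        | ∨.x∙yz≈y∙xz (v′ == u) (u′ == v) (v′ == v) = ∧.x∙yz≈y∙xz (isEdge G u v) (isEdge G u′ v′) _

lineAdj-irr : ∀ {n} (G : Graph n) u v → lineAdj G u v u v ≡ false
lineAdj-irr G u v = begin
  lineAdj G u v u v                 ≡⟨ cong (λ s → e ∧ (e ∧ (share ∧ not s))) (cong₂ _∧_ (==-refl u) (==-refl v)) ⟩
  e ∧ (e ∧ (share ∧ false))         ≡⟨ cong (λ s → e ∧ (e ∧ s)) (∧-zeroʳ share) ⟩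
  e ∧ (e ∧ false)                   ≡⟨ cong (e ∧_) (∧-zeroʳ e) ⟩
  e ∧ false                         ≡⟨ ∧-zeroʳ e ⟩
  false                             ∎
  where
  open ≡-Reasoning
  e share : Bool
  e = isEdge G u v
  share = shareEndpoint u v u v

lineGraph : ∀ {n} → Graph n → Graph (n * n)
lineGraph {n} G = record
  { adj     = λ i j → lineAdj G (fst i) (snd i) (fst j) (snd j)
  ; adj-sym = λ i j → lineAdj-sym G (fst i) (snd i) (fst j) (snd j)
  ; adj-irr = λ i → lineAdj-irr G (fst i) (snd i)
  }
  where
  fst snd : Fin (n * n) → Fin n
  fst = F.quotient n
  snd = F.remainder {n} n

lineGraph-combine : ∀ {n} (G : Graph n) a b c d → adj (lineGraph G) (F.combine a b) (F.combine c d) ≡ lineAdj G a b c d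
lineGraph-combine {n} G a b c d = cong₂ (λ p q → lineAdj G (proj₁ p) (proj₂ p) (proj₁ q) (proj₂ q))
                                        (FP.remQuot-combine {k = n} a b) (FP.remQuot-combine {k = n} c d)

laterNeighbour earlierNeighbour : ∀ {n} → Graph n → Fin n → Fin n → Fin n → Bool
laterNeighbour   G x y w = adj G x w ∧ ((x <ᵇ w) ∧ not (y == w))
earlierNeighbour G x y w = adj G x w ∧ ((w <ᵇ x) ∧ not (y == w))

edgeAtExcept : ∀ {n} → Graph n → Fin n → Fin n → Fin n → Fin n → Bool
edgeAtExcept G x y u′ v′ = ((x == u′) ∧ laterNeighbour G x y v′) ∨ ((x == v′) ∧ earlierNeighbour G x y u′)

count-otherNeighbours : ∀ {n d} (G : Graph n) x y → adj G x y ≡ true → degree G x ≤ suc d →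
  count n (λ w → adj G x w ∧ not (y == w)) ≤ d
count-otherNeighbours {n} {d} G x y xy deg = +-cancelˡ-≤ 1 _ _ (begin
  1 + count n other                                     ≡⟨ cong (_+ count n other) count-y ⟨
  count n (λ w → adj G x w ∧ (y == w)) + count n other  ≡⟨ count-split n (adj G x) (y ==_) ⟨
  degree G x                                            ≤⟨ deg ⟩
  suc d                                                 ∎)
  where
  open ≤-Reasoning
  other : Fin _ → Bool
  other w = adj G x w ∧ not (y == w)
  only-y : ∀ w → adj G x w ∧ (y == w) ≡ (y == w)
  only-y w with y F.≟ w
  ... | yes refl = trans (∧-identityʳ _) xy
  ... | no  _    = ∧-zeroʳ _
  count-y : count n (λ w → adj G x w ∧ (y == w)) ≡ 1
  count-y = trans (count-cong n only-y) (count-== n y)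

count-later+earlier : ∀ {n} (G : Graph n) x y →
  count n (laterNeighbour G x y) + count n (earlierNeighbour G x y) ≤ count n (λ w → adj G x w ∧ not (y == w))
count-later+earlier {n} G x y =
  ≤-trans (+-mono-≤ (count-mono n later⇒) (count-mono n earlier⇒)) (≤-reflexive (sym (count-split n _ (x <ᵇ_))))
  where
  later⇒ : ∀ w → laterNeighbour G x y w ≡ true → (adj G x w ∧ not (y == w)) ∧ (x <ᵇ w) ≡ true
  later⇒ w = trans (sym (∧.x∙yz≈xz∙y (adj G x w) (x <ᵇ w) (not (y == w))))
  earlier⇒ : ∀ w → earlierNeighbour G x y w ≡ true → (adj G x w ∧ not (y == w)) ∧ not (x <ᵇ w) ≡ true
  earlier⇒ w e = cong₂ _∧_ (cong₂ _∧_ (∧-conicalˡ (adj G x w) _ e) (∧-conicalʳ (w <ᵇ x) _ rest))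
                             (cong not (dec-false (x F.<? w) (FP.<-asym (<ᵇ⇒< (∧-conicalˡ _ (not (y == w)) rest)))))
    where
    rest : (w <ᵇ x) ∧ not (y == w) ≡ true
    rest = ∧-conicalʳ (adj G x w) _ e

sumF-count-edgeAtExcept : ∀ {n d} (G : Graph n) x y → adj G x y ≡ true → degree G x ≤ suc d →
  sumF n (λ u′ → count n (edgeAtExcept G x y u′)) ≤ d
sumF-count-edgeAtExcept {n} {d} G x y xy deg = begin
  sumF n (λ u′ → count n (edgeAtExcept G x y u′))
    ≤⟨ sumF-mono n (λ u′ → count-∨ n _ _) ⟩
  sumF n (λ u′ → count n (λ v′ → (x == u′) ∧ later v′) + count n (λ v′ → (x == v′) ∧ earlier u′))
    ≡⟨ sumF-+ n _ _ ⟩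
  sumF n (λ u′ → count n (λ v′ → (x == u′) ∧ later v′))
    + sumF n (λ u′ → count n (λ v′ → (x == v′) ∧ earlier u′))
    ≡⟨ cong₂ _+_ (sumF-count-==ˡ n x later) (sumF-count-==ʳ n x earlier) ⟩
  count n later + count n earlier
    ≤⟨ count-later+earlier G x y ⟩
  count n (λ w → adj G x w ∧ not (y == w))
    ≤⟨ count-otherNeighbours G x y xy deg ⟩
  d ∎
  where
  open ≤-Reasoning
  later earlier : Fin n → Bool
  later   = laterNeighbour G x y
  earlier = earlierNeighbour G x y

shared⇒edgeAtExcept : ∀ {n} (G : Graph n) u v u′ v′ →
  Dec (u ≡ u′) → Dec (u ≡ v′) → Dec (v ≡ u′) → Dec (v ≡ v′) →
  u F.< v → u′ F.< v′ → adj G u′ v′ ≡ true →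
  shareEndpoint u v u′ v′ ≡ true → not ((u == u′) ∧ (v == v′)) ≡ true →
  (edgeAtExcept G u v u′ v′ ∨ edgeAtExcept G v u u′ v′) ≡ true
shared⇒edgeAtExcept G u v u v′ (yes refl) _ _ _ u<v u<v′ e shared distinct =
  ∨-introˡ (edgeAtExcept G v u u v′) (∨-introˡ ((u == v′) ∧ earlierNeighbour G u v u)
    (cong₂ _∧_ (==-refl u) (cong₂ _∧_ e (cong₂ _∧_ (<⇒<ᵇ u<v′) v≠v′))))
  where
  v≠v′ : not (v == v′) ≡ true
  v≠v′ = trans (cong (λ b → not (b ∧ (v == v′))) (sym (==-refl u))) distinct
shared⇒edgeAtExcept G u v u′ u (no _) (yes refl) _ _ u<v u′<u e shared distinct =
  ∨-introˡ (edgeAtExcept G v u u′ u) (∨-introʳ ((u == u′) ∧ laterNeighbour G u v u)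
    (cong₂ _∧_ (==-refl u) (cong₂ _∧_ (trans (adj-sym G u u′) e) (cong₂ _∧_ (<⇒<ᵇ u′<u) (≢⇒not== v≢u′)))))
  where
  v≢u′ : v ≢ u′
  v≢u′ refl = FP.<-asym u<v u′<u
shared⇒edgeAtExcept G u v v v′ (no _) (no u≢v′) (yes refl) _ u<v v<v′ e shared distinct =
  ∨-introʳ (edgeAtExcept G u v v v′) (∨-introˡ ((v == v′) ∧ earlierNeighbour G v u v)
    (cong₂ _∧_ (==-refl v) (cong₂ _∧_ e (cong₂ _∧_ (<⇒<ᵇ v<v′) (≢⇒not== u≢v′)))))
shared⇒edgeAtExcept G u v u′ v (no u≢u′) (no _) (no _) (yes refl) u<v u′<v e shared distinct =
  ∨-introʳ (edgeAtExcept G u v u′ v) (∨-introʳ ((v == u′) ∧ laterNeighbour G v u v)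
    (cong₂ _∧_ (==-refl v) (cong₂ _∧_ (trans (adj-sym G v u′) e) (cong₂ _∧_ (<⇒<ᵇ u′<v) (≢⇒not== u≢u′)))))
shared⇒edgeAtExcept G u v u′ v′ (no u≢u′) (no u≢v′) (no v≢u′) (no v≢v′) _ _ _ shared _
  with () ← trans (sym shared) (cong₂ _∨_ (dec-false (u F.≟ u′) u≢u′) (cong₂ _∨_ (dec-false (u F.≟ v′) u≢v′)
                                 (cong₂ _∨_ (dec-false (v F.≟ u′) v≢u′) (dec-false (v F.≟ v′) v≢v′))))

lineAdj⇒edgeAtExcept : ∀ {n} (G : Graph n) u v u′ v′ → lineAdj G u v u′ v′ ≡ true →
  (edgeAtExcept G u v u′ v′ ∨ edgeAtExcept G v u u′ v′) ≡ true
lineAdj⇒edgeAtExcept G u v u′ v′ adjacent =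
  shared⇒edgeAtExcept G u v u′ v′ (u F.≟ u′) (u F.≟ v′) (v F.≟ u′) (v F.≟ v′)
    (<ᵇ⇒< (∧-conicalˡ _ _ uv)) (<ᵇ⇒< (∧-conicalˡ _ _ u′v′)) (∧-conicalʳ (u′ <ᵇ v′) _ u′v′)
    (∧-conicalˡ _ _ rest) (∧-conicalʳ (shareEndpoint u v u′ v′) _ rest)
  where
  uv : isEdge G u v ≡ true
  uv = ∧-conicalˡ _ _ adjacent
  u′v′ : isEdge G u′ v′ ≡ true
  u′v′ = ∧-conicalˡ _ _ (∧-conicalʳ (isEdge G u v) _ adjacent)
  rest : shareEndpoint u v u′ v′ ∧ not ((u == u′) ∧ (v == v′)) ≡ true
  rest = ∧-conicalʳ (isEdge G u′ v′) _ (∧-conicalʳ (isEdge G u v) _ adjacent)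

sumF-count-lineAdj : ∀ {n d} (G : Graph n) → (∀ v → degree G v ≤ suc d) → ∀ u v →
  sumF n (λ u′ → count n (lineAdj G u v u′)) ≤ d + d
sumF-count-lineAdj {n} {d} G deg u v = byEdge (isEdge G u v) refl
  where
  open ≤-Reasoning
  byEdge : ∀ b → isEdge G u v ≡ b → sumF n (λ u′ → count n (lineAdj G u v u′)) ≤ d + d
  byEdge false notEdge =
    ≤-trans (≤-reflexive (trans (sumF-cong n (λ u′ → count-false n (λ v′ → cong (_∧ (isEdge G u′ v′ ∧ _)) notEdge)))
                                (sumF-zero n)))
            z≤n
  byEdge true  uv      = begin
    sumF n (λ u′ → count n (lineAdj G u v u′))
      ≤⟨ sumF-mono n (λ u′ → count-mono n (lineAdj⇒edgeAtExcept G u v u′)) ⟩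
    sumF n (λ u′ → count n (λ v′ → edgeAtExcept G u v u′ v′ ∨ edgeAtExcept G v u u′ v′))
      ≤⟨ sumF-mono n (λ u′ → count-∨ n _ _) ⟩
    sumF n (λ u′ → count n (edgeAtExcept G u v u′) + count n (edgeAtExcept G v u u′))
      ≡⟨ sumF-+ n _ _ ⟩
    sumF n (λ u′ → count n (edgeAtExcept G u v u′)) + sumF n (λ u′ → count n (edgeAtExcept G v u u′))
      ≤⟨ +-mono-≤ (sumF-count-edgeAtExcept G u v u~v (deg u)) (sumF-count-edgeAtExcept G v u (trans (adj-sym G v u) u~v) (deg v)) ⟩
    d + d ∎
    where
    u~v : adj G u v ≡ true
    u~v = ∧-conicalʳ (u <ᵇ v) _ uv

lineGraph-degree : ∀ {n d} (G : Graph n) → (∀ v → degree G v ≤ suc d) → ∀ i → degree (lineGraph G) i ≤ d + d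
lineGraph-degree {n} G deg i = begin
  degree (lineGraph G) i
    ≡⟨ count-combine n n _ ⟩
  sumF n (λ u′ → count n (λ v′ → lineAdj G u v (F.quotient n (F.combine u′ v′)) (F.remainder {n} n (F.combine u′ v′))))
    ≡⟨ sumF-cong n (λ u′ → count-cong n (λ v′ →
         cong (λ p → lineAdj G u v (proj₁ p) (proj₂ p)) (FP.remQuot-combine u′ v′))) ⟩
  sumF n (λ u′ → count n (lineAdj G u v u′))
    ≤⟨ sumF-count-lineAdj G deg u v ⟩
  _ ∎
  where
  open ≤-Reasoning
  u v : Fin n
  u = F.quotient n i
  v = F.remainder {n} n i

sortPair : ∀ {n} → Fin n → Fin n → Fin n × Fin n
sortPair u v = if u <ᵇ v then (u , v) else (v , u)

sortPair-cases : ∀ {n} (u v : Fin n) →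
  ((u <ᵇ v) ≡ true × sortPair u v ≡ (u , v)) ⊎ ((u <ᵇ v) ≡ false × sortPair u v ≡ (v , u))
sortPair-cases u v with u <ᵇ v
... | true  = inj₁ (refl , refl)
... | false = inj₂ (refl , refl)

sortPair-sym : ∀ {n} {u v : Fin n} → u ≢ v → sortPair u v ≡ sortPair v u
sortPair-sym {u = u} {v} u≢v with sortPair-cases u v | sortPair-cases v u
... | inj₁ (_ , p)   | inj₂ (_ , q)   = trans p (sym q)
... | inj₂ (_ , p)   | inj₁ (_ , q)   = trans p (sym q)
... | inj₁ (u<v , _) | inj₁ (v<u , _) = ⊥-elim (FP.<-asym (<ᵇ⇒< {u = u} {v} u<v) (<ᵇ⇒< {u = v} {u} v<u))
... | inj₂ (u≮v , _) | inj₂ (v≮u , _) with () ← trans (sym (<⇒<ᵇ (<ᵇ≡false⇒> u≢v u≮v))) v≮u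

sortPair-injective : ∀ {n} (u : Fin n) {v w} → sortPair u v ≡ sortPair u w → v ≡ w
sortPair-injective u {v} {w} eq with sortPair-cases u v | sortPair-cases u w
... | inj₁ (_ , p) | inj₁ (_ , q) = cong proj₂ (trans (sym p) (trans eq q))
... | inj₁ (_ , p) | inj₂ (_ , q) = let r = trans (sym p) (trans eq q) in trans (cong proj₂ r) (cong proj₁ r)
... | inj₂ (_ , p) | inj₁ (_ , q) = let r = trans (sym p) (trans eq q) in trans (cong proj₁ r) (cong proj₂ r)
... | inj₂ (_ , p) | inj₂ (_ , q) = cong proj₁ (trans (sym p) (trans eq q))

sortPair-∋ : ∀ {n} (u v : Fin n) → proj₁ (sortPair u v) ≡ u ⊎ proj₂ (sortPair u v) ≡ u
sortPair-∋ u v with sortPair-cases u v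
... | inj₁ (_ , p) = inj₁ (cong proj₁ p)
... | inj₂ (_ , p) = inj₂ (cong proj₂ p)

isEdge-sortPair : ∀ {n} (G : Graph n) {u v} → adj G u v ≡ true → isEdge G (proj₁ (sortPair u v)) (proj₂ (sortPair u v)) ≡ true
isEdge-sortPair G {u} {v} uv with sortPair-cases u v
... | inj₁ (u<v , p) rewrite p = cong₂ _∧_ u<v uv
... | inj₂ (u≮v , p) rewrite p = cong₂ _∧_ (<⇒<ᵇ (<ᵇ≡false⇒> (adj⇒≢ G uv) u≮v)) (trans (adj-sym G v u) uv)

edgeIndex : ∀ {n} → Fin n → Fin n → Fin (n * n)
edgeIndex u v = F.combine (proj₁ (sortPair u v)) (proj₂ (sortPair u v))

isEdgeIndex : ∀ {n} → Graph n → Fin (n * n) → Bool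
isEdgeIndex {n} G i = isEdge G (F.quotient n i) (F.remainder {n} n i)

edgeIndex-sym : ∀ {n} {u v : Fin n} → u ≢ v → edgeIndex u v ≡ edgeIndex v u
edgeIndex-sym u≢v = cong (λ p → F.combine (proj₁ p) (proj₂ p)) (sortPair-sym u≢v)

shareEndpoint-∋ : ∀ {n} (x : Fin n) a b c d → a ≡ x ⊎ b ≡ x → c ≡ x ⊎ d ≡ x → shareEndpoint a b c d ≡ true
shareEndpoint-∋ x .x b .x d (inj₁ refl) (inj₁ refl) = ∨-introˡ _ (==-refl x)
shareEndpoint-∋ x .x b c .x (inj₁ refl) (inj₂ refl) = ∨-introʳ (x == c) (∨-introˡ _ (==-refl x))
shareEndpoint-∋ x a .x .x d (inj₂ refl) (inj₁ refl) = ∨-introʳ (a == x) (∨-introʳ (a == d) (∨-introˡ _ (==-refl x)))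
shareEndpoint-∋ x a .x c .x (inj₂ refl) (inj₂ refl) = ∨-introʳ (a == c) (∨-introʳ (a == x) (∨-introʳ (x == c) (==-refl x)))

≢-pair : ∀ {n} (a b c d : Fin n) → (a , b) ≢ (c , d) → not ((a == c) ∧ (b == d)) ≡ true
≢-pair a b c d ab≢cd with a F.≟ c | b F.≟ d
... | yes a≡c | yes b≡d = ⊥-elim (ab≢cd (cong₂ _,_ a≡c b≡d))
... | yes _   | no  _   = refl
... | no  _   | _       = refl

lineGraph-edgeIndex : ∀ {n} (G : Graph n) {u v w} → adj G u v ≡ true → adj G u w ≡ true → v ≢ w →
  adj (lineGraph G) (edgeIndex u v) (edgeIndex u w) ≡ true
lineGraph-edgeIndex G {u} {v} {w} uv uw v≢w = trans (lineGraph-combine G _ _ _ _)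
  (cong₂ _∧_ (isEdge-sortPair G uv) (cong₂ _∧_ (isEdge-sortPair G uw)
    (cong₂ _∧_ (shareEndpoint-∋ u _ _ _ _ (sortPair-∋ u v) (sortPair-∋ u w))
               (≢-pair _ _ _ _ (v≢w ∘ sortPair-injective u)))))

classCount-isEdgeIndex : ∀ {n k} (G : Graph n) (g : Fin (n * n) → Fin k) c →
  classCount (isEdgeIndex G) g c ≡ sumF n (λ u → count n (λ v → (u <ᵇ v) ∧ (adj G u v ∧ (g (edgeIndex u v) == c))))
classCount-isEdgeIndex {n} G g c = trans (count-combine n n _) (sumF-cong n (λ u → count-cong n (pointwise u)))
  where
  pointwise : ∀ u v → isEdgeIndex G (F.combine u v) ∧ (g (F.combine u v) == c)
                    ≡ (u <ᵇ v) ∧ (adj G u v ∧ (g (edgeIndex u v) == c))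
  pointwise u v = trans (cong₂ _∧_ (cong (λ p → isEdge G (proj₁ p) (proj₂ p)) (FP.remQuot-combine {k = n} u v)) refl)
                         (trans (∧-assoc (u <ᵇ v) (adj G u v) (g (F.combine u v) == c)) (byOrder (sortPair-cases u v)))
    where
    byOrder : ((u <ᵇ v) ≡ true × sortPair u v ≡ (u , v)) ⊎ ((u <ᵇ v) ≡ false × sortPair u v ≡ (v , u)) →
      (u <ᵇ v) ∧ (adj G u v ∧ (g (F.combine u v) == c)) ≡ (u <ᵇ v) ∧ (adj G u v ∧ (g (edgeIndex u v) == c))
    byOrder (inj₁ (_ , p))   = cong (λ q → (u <ᵇ v) ∧ (adj G u v ∧ (g (F.combine (proj₁ q) (proj₂ q)) == c))) (sym p)
    byOrder (inj₂ (u≮v , _)) = trans (cong (_∧ (adj G u v ∧ (g (F.combine u v) == c))) u≮v)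
                                     (sym (cong (_∧ (adj G u v ∧ (g (edgeIndex u v) == c))) u≮v))

-- Total colourings

module _ {n k} {S : SemiGraph n} (τ : TotalColoring S k) (v : Fin n) where

  private
    neighbours : Enumeration n (adj (graph S) v) (degree (graph S) v)
    neighbours = enumerate n (adj (graph S) v)
    neighbour : Fin (degree (graph S) v) → Fin n
    neighbour = proj₁ neighbours
    adjacent : ∀ i → T (adj (graph S) v (neighbour i))
    adjacent i = ≡true⇒T (proj₁ (proj₂ neighbours) i)

  coloursAt : Fin (suc (semiDegree S v)) → Fin k
  coloursAt = vc τ v ∷ ((ec τ v ∘ neighbour) ++ sc τ v)

  coloursAt-injective : Injective _≡_ _≡_ coloursAt
  coloursAt-injective =
    injective-∷ (vc τ v) _ (λ i eq → vertex-apart i (sym eq))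
      (injective-++ (ec τ v ∘ neighbour) (sc τ v)
        (≢⇒injective _ (λ i j i≢j → ee-proper τ v _ _ (adjacent i) (adjacent j) (i≢j ∘ proj₂ (proj₂ neighbours))))
        (≢⇒injective _ (ss-proper τ v)) (λ i s → es-proper τ v (neighbour i) s (adjacent i)))
    where
    vertex-apart : ∀ i → vc τ v ≢ ((ec τ v ∘ neighbour) ++ sc τ v) i
    vertex-apart i with F.splitAt (degree (graph S) v) i
    ... | inj₁ j = ve-proper τ v (neighbour j) (adjacent j)
    ... | inj₂ s = vs-proper τ v s

semiDegree<colours : ∀ {n k} {S : SemiGraph n} → TotalColoring S k → ∀ v → semiDegree S v < k
semiDegree<colours τ v = FP.injective⇒≤ (coloursAt-injective τ v)

edgeClass : ∀ {n k} {S : SemiGraph n} → TotalColoring S k → Fin k → ℕ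
edgeClass {n} {S = S} τ c = sumF n (λ u → count n (λ v → (u <ᵇ v) ∧ (adj (graph S) u v ∧ (ec τ u v == c))))

module Incidences {n k} {S : SemiGraph n} (τ : TotalColoring S k) where

  A : Fin n → Fin n → Bool
  A = adj (graph S)

  edgesAt semisAt incidences : Fin n → Fin k → ℕ
  edgesAt v c    = count n (λ u → A v u ∧ (ec τ v u == c))
  semisAt v c    = count (semi S v) (λ s → sc τ v s == c)
  incidences v c = ⟦ vc τ v == c ⟧ + (edgesAt v c + semisAt v c)

  edgesAt≤1 : ∀ v c → edgesAt v c ≤ 1
  edgesAt≤1 v c = count-==-≤1 n (A v) (ec τ v) c (λ u w vu vw → ee-proper τ v u w (≡true⇒T vu) (≡true⇒T vw))

  semisAt≤1 : ∀ v c → semisAt v c ≤ 1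
  semisAt≤1 v c = count-==-≤1 (semi S v) (λ _ → true) (sc τ v) c (λ s t _ _ → ss-proper τ v s t)

  edgesAt≡0 : ∀ v c → (∀ u → T (A v u) → ec τ v u ≢ c) → edgesAt v c ≡ 0
  edgesAt≡0 v c apart = count-false n (λ u → ∧==-false (apart u ∘ ≡true⇒T))

  semisAt≡0 : ∀ v c → (∀ s → sc τ v s ≢ c) → semisAt v c ≡ 0
  semisAt≡0 v c apart = count-false (semi S v) (λ s → dec-false (sc τ v s F.≟ c) (apart s))

  incidences≤1 : ∀ v c → incidences v c ≤ 1
  incidences≤1 v c = +-≤1 (⟦⟧≤1 (vc τ v == c)) edges+semis≤1 vertex⇒none
    where
    ⟦⟧≤1 : ∀ b → ⟦ b ⟧ ≤ 1
    ⟦⟧≤1 true  = s≤s z≤n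
    ⟦⟧≤1 false = z≤n
    edges+semis≤1 : edgesAt v c + semisAt v c ≤ 1
    edges+semis≤1 = +-≤1 (edgesAt≤1 v c) (semisAt≤1 v c) λ pos →
      let (u , vu) = count-pos⇒witness n _ pos
      in semisAt≡0 v c (λ s sc≡c → es-proper τ v u s (≡true⇒T (∧-conicalˡ _ _ vu))
                                      (trans (==⇒≡ (∧-conicalʳ (A v u) _ vu)) (sym sc≡c)))
    vertex⇒none : 0 < ⟦ vc τ v == c ⟧ → edgesAt v c + semisAt v c ≡ 0
    vertex⇒none pos with vc τ v F.≟ c | pos
    ... | yes refl | _ = cong₂ _+_ (edgesAt≡0 v (vc τ v) (λ u vu → ve-proper τ v u vu ∘ sym))
                                   (semisAt≡0 v (vc τ v) (λ s → vs-proper τ v s ∘ sym))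

  sumF-incidences : ∀ v → sumF k (incidences v) ≡ suc (semiDegree S v)
  sumF-incidences v = begin
    sumF k (incidences v)
      ≡⟨ sumF-+ k _ _ ⟩
    sumF k (λ c → ⟦ vc τ v == c ⟧) + sumF k (λ c → edgesAt v c + semisAt v c)
      ≡⟨ cong₂ _+_ (trans (sumF-⟦⟧ k _) (count-== k (vc τ v))) (sumF-+ k _ _) ⟩
    1 + (sumF k (edgesAt v) + sumF k (semisAt v))
      ≡⟨ cong suc (cong₂ _+_ (count-byValue n k (A v) (ec τ v))
                             (trans (sym (count-true (semi S v))) (count-byValue (semi S v) k (λ _ → true) (sc τ v)))) ⟨
    suc (semiDegree S v) ∎
    where open ≡-Reasoning

  incidences≡1 : (∀ v → suc (semiDegree S v) ≡ k) → ∀ v c → incidences v c ≡ 1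
  incidences≡1 regular v = sumF≡n⇒≡1 k (incidences v) (incidences≤1 v) (trans (sumF-incidences v) (regular v))

  flip : ∀ c v u → (A v u ∧ (ec τ v u == c)) ∧ not (v <ᵇ u) ≡ (u <ᵇ v) ∧ (A u v ∧ (ec τ u v == c))
  flip c v u with A v u in vu
  ... | false = sym (trans (cong (λ a → (u <ᵇ v) ∧ (a ∧ (ec τ u v == c))) (trans (adj-sym (graph S) u v) vu))
                           (∧-zeroʳ (u <ᵇ v)))
  ... | true  = begin
    (ec τ v u == c) ∧ not (v <ᵇ u)
      ≡⟨ cong₂ (λ x y → (x == c) ∧ y) (ec-sym τ v u (≡true⇒T vu)) (not-<ᵇ (adj⇒≢ (graph S) vu)) ⟩
    (ec τ u v == c) ∧ (u <ᵇ v)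
      ≡⟨ ∧-comm (ec τ u v == c) (u <ᵇ v) ⟩
    (u <ᵇ v) ∧ (ec τ u v == c)
      ≡⟨ cong (λ a → (u <ᵇ v) ∧ (a ∧ (ec τ u v == c))) (trans (adj-sym (graph S) u v) vu) ⟨
    (u <ᵇ v) ∧ (A u v ∧ (ec τ u v == c)) ∎
    where open ≡-Reasoning

  sumF-edgesAt : ∀ c → sumF n (λ v → edgesAt v c) ≡ edgeClass τ c + edgeClass τ c
  sumF-edgesAt c = begin
    sumF n (λ v → edgesAt v c)
      ≡⟨ sumF-cong n (λ v → count-split n _ (v <ᵇ_)) ⟩
    sumF n (λ v → count n (λ u → P v u ∧ (v <ᵇ u)) + count n (λ u → P v u ∧ not (v <ᵇ u)))
      ≡⟨ sumF-+ n _ _ ⟩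
    sumF n (λ v → count n (λ u → P v u ∧ (v <ᵇ u))) + sumF n (λ v → count n (λ u → P v u ∧ not (v <ᵇ u)))
      ≡⟨ cong₂ _+_ (sumF-cong n (λ v → count-cong n (λ u → ∧-comm (P v u) (v <ᵇ u))))
                   (trans (sumF-count-comm n n _) (sumF-cong n (λ u → count-cong n (λ v → flip c v u)))) ⟩
    edgeClass τ c + edgeClass τ c ∎
    where
    open ≡-Reasoning
    P : Fin n → Fin n → Bool
    P v u = A v u ∧ (ec τ v u == c)

  -- Every colour occurs exactly once at each vertex; summing over the vertices counts every vertex and
  -- semi-edge of a colour class once and every edge twice.
  classSize+edgeClass : (∀ v → suc (semiDegree S v) ≡ k) → ∀ c → classSize τ c + edgeClass τ c ≡ n
  classSize+edgeClass regular c = begin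
    V + E + Sc + E
      ≡⟨ rearrange V E Sc ⟩
    V + ((E + E) + Sc)
      ≡⟨ cong (λ x → V + (x + Sc)) (sumF-edgesAt c) ⟨
    V + (sumF n (λ v → edgesAt v c) + Sc)
      ≡⟨ cong₂ _+_ (sumF-⟦⟧ n _) (sumF-+ n _ _) ⟨
    sumF n (λ v → ⟦ vc τ v == c ⟧) + sumF n (λ v → edgesAt v c + semisAt v c)
      ≡⟨ sumF-+ n _ _ ⟨
    sumF n (λ v → incidences v c)
      ≡⟨ sumF-cong n (λ v → incidences≡1 regular v c) ⟩
    sumF n (λ _ → 1)
      ≡⟨ trans (sumF-⟦⟧ n (λ _ → true)) (count-true n) ⟩
    n ∎
    where
    open ≡-Reasoning
    V E Sc : ℕ
    V  = count n (λ v → vc τ v == c)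
    E  = edgeClass τ c
    Sc = sumF n (λ v → semisAt v c)
    rearrange : ∀ a b s → a + b + s + b ≡ a + ((b + b) + s)
    rearrange = solve 3 (λ a b s → a :+ b :+ s :+ b := a :+ ((b :+ b) :+ s)) refl

balancedEdges⇒equitable : ∀ {n k} {S : SemiGraph n} (τ : TotalColoring S k) → (∀ v → suc (semiDegree S v) ≡ k) →
  (∀ c d → edgeClass τ c ≤ suc (edgeClass τ d)) → Equitable τ
balancedEdges⇒equitable τ regular balanced c d = +-cancelʳ-≤ (edgeClass τ c) _ _ (begin
  classSize τ c + edgeClass τ c         ≡⟨ classSize+edgeClass regular c ⟩
  _                                     ≡⟨ classSize+edgeClass regular d ⟨
  classSize τ d + edgeClass τ d         ≤⟨ +-monoʳ-≤ (classSize τ d) (balanced d c) ⟩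
  classSize τ d + suc (edgeClass τ c)   ≡⟨ +-suc _ _ ⟩
  suc (classSize τ d) + edgeClass τ c   ∎)
  where
  open ≤-Reasoning
  open Incidences τ

module Construction {n} (G : Graph n) (cubic : Cubic G) (h : ℕ) (4≤h : 4 ≤ h) where

  k : ℕ
  k = 4 + h

  S : SemiGraph n
  S = semiCorona G h

  regular : ∀ v → suc (semiDegree S v) ≡ k
  regular v = cong (λ d → suc (d + h)) (cubic v)

  edgeColouring : Σ (Fin (n * n) → Fin k) λ g → ProperColouring (lineGraph G) g × Balanced (isEdgeIndex G) g
  edgeColouring = equitableColouring 4 k (+-monoʳ-≤ 4 4≤h) (m<m+n 4 (≤-trans (s≤s z≤n) 4≤h)) (lineGraph G) (isEdgeIndex G)
                    (λ i j → ∧-conicalˡ (isEdgeIndex G i) _) (lineGraph-degree G (≤-reflexive ∘ cubic))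

  edgeColour : Fin n → Fin n → Fin k
  edgeColour u v = proj₁ edgeColouring (edgeIndex u v)

  forbidden : Fin n → Fin k → Bool
  forbidden v c = anyF n (λ u → adj G v u ∧ (edgeColour v u == c))

  forbidden-edge : ∀ {v u} → adj G v u ≡ true → forbidden v (edgeColour v u) ≡ true
  forbidden-edge {v} {u} vu = anyF-intro n _ u (cong₂ _∧_ vu (==-refl (edgeColour v u)))

  vertexColouring : Σ (Fin n → Fin k) λ col → ProperColouring G col × (∀ v → forbidden v (col v) ≡ false)
  vertexColouring = greedyColouring 3 3 k (+-monoʳ-≤ 4 (≤-trans (n≤1+n 3) 4≤h)) G (≤-reflexive ∘ cubic)
                      forbidden (λ v → ≤-trans (count-image n k (adj G v) (edgeColour v)) (≤-reflexive (cubic v)))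

  vertexColour : Fin n → Fin k
  vertexColour = proj₁ vertexColouring

  used : Fin n → Fin k → Bool
  used v c = (vertexColour v == c) ∨ forbidden v c

  count-used : ∀ v → count k (used v) ≤ 4
  count-used v = ≤-trans (count-∨ k (vertexColour v ==_) (forbidden v))
    (+-mono-≤ (≤-reflexive (count-== k (vertexColour v)))
              (≤-trans (count-image n k (adj G v) (edgeColour v)) (≤-reflexive (cubic v))))

  h≤unused : ∀ v → h ≤ count k (not ∘ used v)
  h≤unused v = +-cancelˡ-≤ 4 h _ (begin
    k                                           ≡⟨ count-complement k (used v) ⟨
    count k (used v) + count k (not ∘ used v)   ≤⟨ +-monoˡ-≤ _ (count-used v) ⟩
    4 + count k (not ∘ used v)                  ∎)
    where open ≤-Reasoning

  unusedColours : ∀ v → Enumeration k (not ∘ used v) (count k (not ∘ used v))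
  unusedColours v = enumerate k (not ∘ used v)

  semiColour : (v : Fin n) → Fin h → Fin k
  semiColour v s = proj₁ (unusedColours v) (F.inject≤ s (h≤unused v))

  semiColour-unused : ∀ v s → used v (semiColour v s) ≡ false
  semiColour-unused v s = not≡true⇒≡false (proj₁ (proj₂ (unusedColours v)) _)

  τ : TotalColoring S k
  τ = record
    { vc = vertexColour
    ; ec = edgeColour
    ; sc = semiColour
    ; ec-sym    = λ u v uv → cong (proj₁ edgeColouring) (edgeIndex-sym (adj⇒≢ G (T⇒≡true uv)))
    ; vv-proper = λ u v uv → proj₁ (proj₂ vertexColouring) u v (T⇒≡true uv)
    ; ee-proper = λ u v w uv uw v≢w →
                    proj₁ (proj₂ edgeColouring) _ _ (lineGraph-edgeIndex G (T⇒≡true uv) (T⇒≡true uw) v≢w)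
    ; es-proper = λ u v s uv → separates (used u) (∨-introʳ (vertexColour u == edgeColour u v) (forbidden-edge (T⇒≡true uv)))
                                                  (semiColour-unused u s)
    ; ss-proper = λ u s t s≢t eq → s≢t (FP.inject≤-injective _ _ s t (proj₂ (proj₂ (unusedColours u)) eq))
    ; ve-proper = λ u v uv → separates (forbidden u) (forbidden-edge (T⇒≡true uv)) (proj₂ (proj₂ vertexColouring) u) ∘ sym
    ; vs-proper = λ u s → separates (used u) (∨-introˡ (forbidden u (vertexColour u)) (==-refl (vertexColour u)))
                                             (semiColour-unused u s)
    }

  edgesBalanced : ∀ c d → edgeClass τ c ≤ suc (edgeClass τ d)
  edgesBalanced c d = subst₂ (λ x y → x ≤ suc y) (classCount-isEdgeIndex G g c) (classCount-isEdgeIndex G g d)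
                        (proj₂ (proj₂ edgeColouring) c d)
    where
    g : Fin (n * n) → Fin k
    g = proj₁ edgeColouring

  equitable : Equitable τ
  equitable = balancedEdges⇒equitable τ regular edgesBalanced

lemma1 : ∀ {n : ℕ} (G : Graph n) (h : ℕ) → 1 ≤ n → Cubic G → 4 ≤ h →
    MaxDegree (semiCorona G h) (h + 3)
    × EquitableTotalChromaticNumber (semiCorona G h) (suc (h + 3))
    × EquitableTotalChromaticNumber (semiCorona G h) (h + 4)
lemma1 {suc n} G h _ cubic 4≤h = maxDegree , chromatic (cong suc (+-comm 3 h)) , chromatic (+-comm 4 h)
  where
  open Construction G cubic h 4≤h using (τ; equitable)

  semiDegree≡ : ∀ v → semiDegree (semiCorona G h) v ≡ h + 3
  semiDegree≡ v = trans (cong (_+ h) (cubic v)) (+-comm 3 h)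

  maxDegree : MaxDegree (semiCorona G h) (h + 3)
  maxDegree = ≤-reflexive ∘ semiDegree≡ , zero , semiDegree≡ zero

  chromatic : ∀ {k} → 4 + h ≡ k → EquitableTotalChromaticNumber (semiCorona G h) k
  chromatic refl = (τ , equitable) , λ j j<k (σ , _) →
    <⇒≱ j<k (subst (_≤ j) (cong (λ d → suc (d + h)) (cubic zero)) (semiDegree<colours σ zero))
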